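{- Let $G=(X,Y)$ be a bipartite graph with $|X|=n$ such that $\deg(y)>\frac{n+1}{2}$ for every $y\in Y$. Suppose $x\in X$ and $y\in Y$ are non-adjacent with $\deg(x)+\deg(y)\ge n+1$. Then $G+xy$ contains a cycle containing all vertices of $X$ if and only if $G$ contains a cycle containing all vertices of $X$.
   Context: All graphs are finite and simple; $G+xy$ is the graph obtained from $G$ by adding the edge $xy$. -}

module Defs where

open import Data.Nat using (ℕ; zero; suc; _+_; _*_; _≤_; _<_)
open import Data.Nat.DivMod using (_%_; m%n<n)
open import Data.Fin as Fin using (Fin; toℕ; fromℕ<)
open import Data.Fin.Properties as FinP using ()
open import Data.Sum using (_⊎_; inj₁; inj₂)
open import Data.Bool using (Bool; true; false; T; if_then_else_; _∧_)
open import Data.List using (List; map; allFin)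
open import Data.Nat.ListAction using (sum)
open import Data.Product using (Σ; _×_; ∃)
open import Data.Empty using (⊥)
open import Relation.Binary.PropositionalEquality using (_≡_)
open import Relation.Nullary.Decidable using (⌊_⌋)
open import Function.Definitions using (Injective)

-- A bipartite graph G = (X, Y) with X = Fin n, Y = Fin m, given by its
-- (Boolean, hence decidable) X–Y adjacency relation.  Simple by construction.
BipGraph : ℕ → ℕ → Set
BipGraph n m = Fin n → Fin m → Bool

Vertex : ℕ → ℕ → Set
Vertex n m = Fin n ⊎ Fin m

Adj : ∀ {n m} → BipGraph n m → Vertex n m → Vertex n m → Set
Adj E (inj₁ a) (inj₂ b) = T (E a b)
Adj E (inj₂ b) (inj₁ a) = T (E a b)
Adj E (inj₁ _) (inj₁ _) = ⊥
Adj E (inj₂ _) (inj₂ _) = ⊥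

private
  ind : Bool → ℕ
  ind true = 1
  ind false = 0

degX : ∀ {n m} → BipGraph n m → Fin n → ℕ
degX {m = m} E a = sum (map (λ b → ind (E a b)) (allFin m))

degY : ∀ {n m} → BipGraph n m → Fin m → ℕ
degY {n = n} E b = sum (map (λ a → ind (E a b)) (allFin n))

addEdge : ∀ {n m} → BipGraph n m → Fin n → Fin m → BipGraph n m
addEdge E x y a b = if ⌊ a Fin.≟ x ⌋ ∧ ⌊ b Fin.≟ y ⌋ then true else E a b

next : ∀ {k} → Fin (suc k) → Fin (suc k)
next {k} i = fromℕ< (m%n<n (suc (toℕ i)) (suc k))

IsCycle : ∀ {n m} → BipGraph n m → (k : ℕ) → (Fin (suc k) → Vertex n m) → Set
IsCycle E k c = (3 ≤ suc k) × Injective _≡_ _≡_ c × (∀ i → Adj E (c i) (c (next i)))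

HasCycleThroughX : ∀ {n m} → BipGraph n m → Set
HasCycleThroughX {n} {m} E =
  Σ ℕ λ k → Σ (Fin (suc k) → Vertex n m) λ c →
    IsCycle E k c × (∀ (x : Fin n) → ∃ λ i → c i ≡ inj₁ x)

{-# OPTIONS --safe #-}

-- If a cycle of G + xy through X uses the new edge, removing it leaves a path
-- x = p 0, …, p k = y of G through X.  Whenever x ~ p (j+1) and p j ~ y, Pósa's
-- rotation p 0 … p j p k … p (j+1) closes it into a cycle of G.  If no such j exists
-- and all neighbours of x lie on the path, b ↦ (the vertex before b) maps N(x)
-- injectively into X ∖ N(y), so deg x + deg y ≤ n.  If some neighbour z of x is off
-- the path, prepend z and rotate at z ~ p (j+1), p (j-1) ~ y, dropping p j ∈ Y; if that
-- fails too, a ↦ (the vertex two before a) maps N(z) ∖ {x} injectively into X ∖ N(y),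
-- so deg z + deg y ≤ n + 1, contradicting deg > (n+1)/2 on Y.

module Submission where

open import Defs
open import Data.Bool using (Bool; true; false; T; not; _∧_; if_then_else_)
open import Data.Empty using (⊥-elim)
open import Data.Fin as Fin using (Fin; zero; suc; toℕ; fromℕ<)
open import Data.Fin.Properties
  using (toℕ-fromℕ<; fromℕ<-cong; fromℕ<-toℕ; toℕ<n; toℕ-injective; any?)
import Data.Fin.Properties as Finₚ
open import Data.List using (map; allFin; tabulate)
open import Data.List.Properties using (map-tabulate)
open import Data.Nat
open import Data.Nat.Properties
open import Data.Nat.DivMod using (_%_; _mod_; m<n⇒m%n≡m; n%n≡0; m%n%n≡m%n; %-distribˡ-+)
open import Data.Nat.ListAction using (sum)
open import Data.Nat.Tactic.RingSolver using (solve-∀)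
open import Data.Product using (∃₂; ∃-syntax; _×_; _,_; proj₂)
open import Data.Sum using (_⊎_; inj₁; inj₂)
open import Data.Sum.Properties using (inj₁-injective; inj₂-injective; ≡-dec)
open import Data.Unit using (tt)
open import Function using (_∘_; id)
open import Function.Bundles using (_⇔_; mk⇔)
open import Relation.Binary.Definitions using (DecidableEquality)
open import Relation.Binary.PropositionalEquality
open import Relation.Nullary using (¬_; Dec; yes; no; ¬?; _×-dec_; contradiction)
open import Relation.Nullary.Decidable using (⌊_⌋; does; T?; decidable-stable)

private variable
  A : Set
  n m k L : ℕ

count : (Fin m → Bool) → ℕ
count {zero}  P = 0
count {suc m} P = (if P zero then 1 else 0) + count (P ∘ suc)

map-tabulate-suc : (f : Fin (suc m) → A) → map f (tabulate suc) ≡ map (f ∘ suc) (allFin m)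
map-tabulate-suc f = trans (map-tabulate suc f) (sym (map-tabulate id (f ∘ suc)))

degX≡count : (E : BipGraph n m) (a : Fin n) → degX E a ≡ count (E a)
degX≡count {m = zero}  E a = refl
degX≡count {m = suc m} E a with E a zero
... | true  = cong suc (trans (cong sum (map-tabulate-suc {m} _)) (degX≡count (λ a′ → E a′ ∘ suc) a))
... | false = trans (cong sum (map-tabulate-suc {m} _)) (degX≡count (λ a′ → E a′ ∘ suc) a)

degY≡count : (E : BipGraph n m) (b : Fin m) → degY E b ≡ count (λ a → E a b)
degY≡count E b = degX≡count (λ b′ a → E a b′) b

count-not+count : (P : Fin m → Bool) → count (not ∘ P) + count P ≡ m
count-not+count {zero}  P = refl
count-not+count {suc m} P with P zero
... | true  = trans (+-suc _ _) (cong suc (count-not+count (P ∘ suc)))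
... | false = cong suc (count-not+count (P ∘ suc))

-- does rather than ⌊_⌋, so that (P ∖ suc a) ∘ suc reduces to (P ∘ suc) ∖ a.
_∖_ : (Fin m → Bool) → Fin m → (Fin m → Bool)
(P ∖ a) b = not (does (b Fin.≟ a)) ∧ P b

∖-intro : {P : Fin m → Bool} {a b : Fin m} → b ≢ a → T (P b) → T ((P ∖ a) b)
∖-intro {a = a} {b} b≢a Pb with b Fin.≟ a
... | yes b≡a = contradiction b≡a b≢a
... | no _    = Pb

∖-elim : {P : Fin m → Bool} {a b : Fin m} → T ((P ∖ a) b) → b ≢ a × T (P b)
∖-elim {a = a} {b} Pb with b Fin.≟ a
... | no b≢a = b≢a , Pb

count-∖ : (P : Fin m → Bool) {a : Fin m} → T (P a) → count P ≡ suc (count (P ∖ a))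
count-∖ {suc m} P {zero} Pa with P zero
... | true = refl
count-∖ {suc m} P {suc a} Pa = trans (cong (head +_) (count-∖ (P ∘ suc) Pa)) (+-suc head _)
  where
  head : ℕ
  head = if P zero then 1 else 0

injection⇒count≤ : (P : Fin m → Bool) (Q : Fin n → Bool) (R : Fin m → Fin n → Set) →
                   (∀ {b} → T (P b) → ∃[ a ] R b a × T (Q a)) →
                   (∀ {b b′ a} → R b a → R b′ a → b ≡ b′) →
                   count P ≤ count Q
injection⇒count≤ {zero}  P Q R image functional = z≤n
injection⇒count≤ {suc m} P Q R image functional with P zero | image {zero}
... | false | _ =
  injection⇒count≤ (P ∘ suc) Q (R ∘ suc) image (λ r r′ → Finₚ.suc-injective (functional r r′))
... | true  | image₀ with image₀ tt
...   | a₀ , r₀ , Qa₀ = begin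
  suc (count (P ∘ suc))
    ≤⟨ s≤s (injection⇒count≤ (P ∘ suc) (Q ∖ a₀) (R ∘ suc) image′ functional′) ⟩
  suc (count (Q ∖ a₀))  ≡⟨ count-∖ Q Qa₀ ⟨
  count Q               ∎
  where
  open ≤-Reasoning
  functional′ : ∀ {b b′ a} → R (suc b) a → R (suc b′) a → b ≡ b′
  functional′ r r′ = Finₚ.suc-injective (functional r r′)
  image′ : ∀ {b} → T (P (suc b)) → ∃[ a ] R (suc b) a × T ((Q ∖ a₀) a)
  image′ Pb with image Pb
  ... | a , r , Qa = a , r , ∖-intro {P = Q} (λ { refl → Finₚ.0≢1+n (functional r₀ r) }) Qa

module _ (E : BipGraph n m) where

  Adj-sym : ∀ {u v} → Adj E u v → Adj E v u
  Adj-sym {inj₁ _} {inj₂ _} e = e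
  Adj-sym {inj₂ _} {inj₁ _} e = e

  Adj? : (u v : Vertex n m) → Dec (Adj E u v)
  Adj? (inj₁ a) (inj₂ b) = T? (E a b)
  Adj? (inj₂ b) (inj₁ a) = T? (E a b)
  Adj? (inj₁ _) (inj₁ _) = no λ ()
  Adj? (inj₂ _) (inj₂ _) = no λ ()

  neighbour-of-Y : ∀ {u b} → Adj E u (inj₂ b) → ∃[ a ] u ≡ inj₁ a
  neighbour-of-Y {inj₁ a} _ = a , refl

  neighbour-of-X : ∀ {u a} → Adj E u (inj₁ a) → ∃[ b ] u ≡ inj₂ b
  neighbour-of-X {inj₂ b} _ = b , refl

_≟ᵛ_ : DecidableEquality (Vertex n m)
_≟ᵛ_ = ≡-dec Fin._≟_ Fin._≟_

-- Vertex sequences are functions ℕ → A of which only the first L values matter.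
Visits : (ℕ → A) → ℕ → A → Set
Visits p L v = ∃[ t ] t < L × p t ≡ v

Visits? : DecidableEquality A → (p : ℕ → A) (L : ℕ) (v : A) → Dec (Visits p L v)
Visits? _≟_ p L v = anyUpTo? (λ t → p t ≟ v) L

CoversX : (ℕ → Vertex n m) → ℕ → Set
CoversX p L = ∀ a → Visits p L (inj₁ a)

infixr 5 _◂_ _⟨_⟩++_

_◂_ : A → (ℕ → A) → ℕ → A
(v ◂ p) zero    = v
(v ◂ p) (suc t) = p t

reverse : ℕ → (ℕ → A) → ℕ → A
reverse k p t = p (k ∸ t)

_⟨_⟩++_ : (ℕ → A) → ℕ → (ℕ → A) → ℕ → A
p ⟨ zero  ⟩++ q = p 0 ◂ q
p ⟨ suc a ⟩++ q = p 0 ◂ (p ∘ suc) ⟨ a ⟩++ q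

++-left : ∀ {p q : ℕ → A} {a t} → t ≤ a → (p ⟨ a ⟩++ q) t ≡ p t
++-left {a = zero}  z≤n       = refl
++-left {a = suc a} z≤n       = refl
++-left {a = suc a} (s≤s t≤a) = ++-left t≤a

++-right : ∀ {p q : ℕ → A} a {t} → (p ⟨ a ⟩++ q) (suc a + t) ≡ q t
++-right zero    = refl
++-right (suc a) = ++-right a

≤⊎≡1+ : ∀ a t → t ≤ a ⊎ ∃[ s ] t ≡ suc a + s
≤⊎≡1+ a t with t ≤? a
... | yes t≤a = inj₁ t≤a
... | no  t≰a = inj₂ (t ∸ suc a , sym (m+[n∸m]≡n (≰⇒> t≰a)))

module _ {p q : ℕ → A} {a : ℕ} {v : A} where

  Visits-++ˡ : Visits p (suc a) v → Visits (p ⟨ a ⟩++ q) (suc a + L) v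
  Visits-++ˡ (t , t≤a , pt≡v) = t , ≤-trans t≤a (m≤m+n (suc a) _) , trans (++-left (≤-pred t≤a)) pt≡v

  Visits-++ʳ : Visits q L v → Visits (p ⟨ a ⟩++ q) (suc a + L) v
  Visits-++ʳ (t , t<L , qt≡v) = suc a + t , +-monoʳ-< (suc a) t<L , trans (++-right a) qt≡v

  Visits-++⁻ : Visits (p ⟨ a ⟩++ q) (suc a + L) v → Visits p (suc a) v ⊎ Visits q L v
  Visits-++⁻ (t , t< , eq) with ≤⊎≡1+ a t
  ... | inj₁ t≤a        = inj₁ (t , s≤s t≤a , trans (sym (++-left t≤a)) eq)
  ... | inj₂ (s , refl) = inj₂ (s , +-cancelˡ-< (suc a) s _ t< , trans (sym (++-right a)) eq)

Visits-reverse : ∀ {p : ℕ → A} {v} → Visits p (suc k) v → Visits (reverse k p) (suc k) v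
Visits-reverse {k = k} {p} (t , t≤k , pt≡v) =
  k ∸ t , s≤s (m∸n≤m k t) , trans (cong p (m∸[m∸n]≡n (≤-pred t≤k))) pt≡v

record IsPath (E : BipGraph n m) (p : ℕ → Vertex n m) (L : ℕ) : Set where
  field
    adj : ∀ {t} → suc t < L → Adj E (p t) (p (suc t))
    inj : ∀ {s t} → s < L → t < L → p s ≡ p t → s ≡ t

open IsPath

module _ {E : BipGraph n m} where

  IsPath-≤ : ∀ {p L′} → L′ ≤ L → IsPath E p L → IsPath E p L′
  IsPath-≤ L′≤L P = record
    { adj = λ t<L′ → adj P (≤-trans t<L′ L′≤L)
    ; inj = λ s<L′ t<L′ → inj P (≤-trans s<L′ L′≤L) (≤-trans t<L′ L′≤L)
    }

  IsPath-drop : ∀ {p} d → IsPath E p (d + L) → IsPath E (λ t → p (d + t)) L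
  IsPath-drop {L = L} {p = p} d P = record
    { adj = λ {t} t<L → subst (Adj E (p (d + t)) ∘ p) (sym (+-suc d t))
                             (adj P (subst (_< d + L) (+-suc d t) (+-monoʳ-< d t<L)))
    ; inj = λ s<L t<L eq → +-cancelˡ-≡ d _ _ (inj P (+-monoʳ-< d s<L) (+-monoʳ-< d t<L) eq)
    }

  IsPath-◂ : ∀ {p v} → IsPath E p L → Adj E v (p 0) → ¬ Visits p L v → IsPath E (v ◂ p) (suc L)
  IsPath-◂ {L = L} {p = p} {v} P v~p₀ v∉p = record { adj = adj′ ; inj = inj′ }
    where
    adj′ : ∀ {t} → suc t < suc L → Adj E ((v ◂ p) t) ((v ◂ p) (suc t))
    adj′ {zero}  _     = v~p₀
    adj′ {suc t} t<L   = adj P (≤-pred t<L)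
    inj′ : ∀ {s t} → s < suc L → t < suc L → (v ◂ p) s ≡ (v ◂ p) t → s ≡ t
    inj′ {zero}  {zero}  _   _   _  = refl
    inj′ {zero}  {suc t} _   t<L eq = contradiction (t , ≤-pred t<L , sym eq) v∉p
    inj′ {suc s} {zero}  s<L _   eq = contradiction (s , ≤-pred s<L , eq) v∉p
    inj′ {suc s} {suc t} s<L t<L eq = cong suc (inj P (≤-pred s<L) (≤-pred t<L) eq)

  IsPath-++ : ∀ {p q} a → IsPath E p (suc a) → IsPath E q L → Adj E (p a) (q 0) →
              (∀ {v} → Visits p (suc a) v → ¬ Visits q L v) →
              IsPath E (p ⟨ a ⟩++ q) (suc a + L)
  IsPath-++ zero P Q pₐ~q₀ disjoint = IsPath-◂ Q pₐ~q₀ (disjoint (0 , s≤s z≤n , refl))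
  IsPath-++ {L = L} {p = p} {q} (suc a) P Q pₐ~q₀ disjoint =
    IsPath-◂ (IsPath-++ a (IsPath-drop 1 P) Q pₐ~q₀ (disjoint ∘ Visits-suc))
             (subst (Adj E (p 0)) (sym (++-left {p = p ∘ suc} {q} {a} z≤n)) (adj P (s≤s (s≤s z≤n))))
             p₀∉rest
    where
    Visits-suc : ∀ {v} → Visits (p ∘ suc) (suc a) v → Visits p (suc (suc a)) v
    Visits-suc (t , t<a , eq) = suc t , s≤s t<a , eq
    p₀∉rest : ¬ Visits ((p ∘ suc) ⟨ a ⟩++ q) (suc a + L) (p 0)
    p₀∉rest v with Visits-++⁻ v
    ... | inj₁ (t , t<a , eq) = 0≢1+n (inj P (s≤s z≤n) (s≤s t<a) (sym eq))
    ... | inj₂ p₀∈q           = disjoint (0 , s≤s z≤n , refl) p₀∈q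

  IsPath-reverse : ∀ {p} → IsPath E p (suc k) → IsPath E (reverse k p) (suc k)
  IsPath-reverse {k = k} {p} P = record { adj = adj′ ; inj = inj′ }
    where
    adj′ : ∀ {t} → suc t < suc k → Adj E (p (k ∸ t)) (p (k ∸ suc t))
    adj′ {t} t<k = subst (λ s → Adj E (p s) (p (k ∸ suc t))) 1+k∸[1+t]≡k∸t
                         (Adj-sym E {p (k ∸ suc t)} (adj P (s≤s 1+k∸[1+t]≤k)))
      where
      1+k∸[1+t]≡k∸t : suc (k ∸ suc t) ≡ k ∸ t
      1+k∸[1+t]≡k∸t = sym (+-∸-assoc 1 (≤-pred t<k))
      1+k∸[1+t]≤k : suc (k ∸ suc t) ≤ k
      1+k∸[1+t]≤k = subst (_≤ k) (sym 1+k∸[1+t]≡k∸t) (m∸n≤m k t)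
    inj′ : ∀ {s t} → s < suc k → t < suc k → p (k ∸ s) ≡ p (k ∸ t) → s ≡ t
    inj′ {s} {t} s≤k t≤k eq =
      ∸-cancelˡ-≡ (≤-pred s≤k) (≤-pred t≤k) (inj P (s≤s (m∸n≤m k s)) (s≤s (m∸n≤m k t)) eq)

record XCycle (E : BipGraph n m) (k : ℕ) (p : ℕ → Vertex n m) : Set where
  field
    path   : IsPath E p (suc k)
    closes : Adj E (p k) (p 0)
    long   : 2 ≤ k
    covers : CoversX p (suc k)

record XYPath (E : BipGraph n m) (x : Fin n) (y : Fin m) (k : ℕ) (p : ℕ → Vertex n m) : Set where
  field
    path   : IsPath E p (suc k)
    start  : p 0 ≡ inj₁ x
    end    : p k ≡ inj₂ y
    long   : 2 ≤ k
    covers : CoversX p (suc k)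

toℕ-next : (i : Fin (suc k)) → toℕ i < k → toℕ (next i) ≡ suc (toℕ i)
toℕ-next i i<k = trans (toℕ-fromℕ< _) (m<n⇒m%n≡m (s≤s i<k))

toℕ-next-last : (i : Fin (suc k)) → toℕ i ≡ k → toℕ (next i) ≡ 0
toℕ-next-last {k} i i≡k = trans (toℕ-fromℕ< _) (trans (cong (λ t → suc t % suc k) i≡k) (n%n≡0 (suc k)))

next-mod : ∀ t → next (t mod suc k) ≡ suc t mod suc k
next-mod {k} t = fromℕ<-cong _ _ (begin
  suc (toℕ (t mod N)) % N     ≡⟨ cong (λ r → suc r % N) (toℕ-fromℕ< _) ⟩
  (1 + t % N) % N             ≡⟨ %-distribˡ-+ 1 (t % N) N ⟩
  (1 % N + t % N % N) % N     ≡⟨ cong (λ r → (1 % N + r) % N) (m%n%n≡m%n t N) ⟩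
  (1 % N + t % N) % N         ≡⟨ %-distribˡ-+ 1 t N ⟨
  suc t % N                   ∎) _ _
  where
  open ≡-Reasoning
  N : ℕ
  N = suc k

mod-injective : ∀ {s t} → s < suc k → t < suc k → s mod suc k ≡ t mod suc k → s ≡ t
mod-injective {k} {s} {t} s<N t<N eq = begin
  s                    ≡⟨ m<n⇒m%n≡m s<N ⟨
  s % suc k            ≡⟨ toℕ-fromℕ< _ ⟨
  toℕ (s mod suc k)    ≡⟨ cong toℕ eq ⟩
  toℕ (t mod suc k)    ≡⟨ toℕ-fromℕ< _ ⟩
  t % suc k            ≡⟨ m<n⇒m%n≡m t<N ⟩
  t                    ∎
  where open ≡-Reasoning

toℕ-mod : (i : Fin (suc k)) → toℕ i mod suc k ≡ i
toℕ-mod i = trans (fromℕ<-cong _ _ (m<n⇒m%n≡m (toℕ<n i)) _ (toℕ<n i)) (fromℕ<-toℕ i _)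

module _ {E : BipGraph n m} where

  XCycle⇒HasCycleThroughX : ∀ {p} → XCycle E k p → HasCycleThroughX E
  XCycle⇒HasCycleThroughX {k = k} {p} C = k , p ∘ toℕ , (s≤s long , inj′ , adj′) , covers′
    where
    open XCycle C
    inj′ : ∀ {i j} → p (toℕ i) ≡ p (toℕ j) → i ≡ j
    inj′ eq = toℕ-injective (inj path (toℕ<n _) (toℕ<n _) eq)
    adj′ : ∀ i → Adj E (p (toℕ i)) (p (toℕ (next i)))
    adj′ i with toℕ i <? k
    ... | yes i<k = subst (Adj E (p (toℕ i)) ∘ p) (sym (toℕ-next i i<k)) (adj path (s≤s i<k))
    ... | no  i≮k = subst₂ (λ s t → Adj E (p s) (p t)) (sym i≡k) (sym (toℕ-next-last i i≡k)) closes
      where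
      i≡k : toℕ i ≡ k
      i≡k = ≤-antisym (≤-pred (toℕ<n i)) (≮⇒≥ i≮k)
    covers′ : ∀ a → ∃[ i ] p (toℕ i) ≡ inj₁ a
    covers′ a with covers a
    ... | t , t<N , pt≡a = fromℕ< t<N , trans (cong p (toℕ-fromℕ< t<N)) pt≡a

  HasCycleThroughX⇒XCycle : HasCycleThroughX E → ∃₂ (XCycle E)
  HasCycleThroughX⇒XCycle (k , c , (3≤N , c-inj , c-adj) , c-covers) = k , p , record
    { path   = record { adj = λ {t} _ → adj-all t ; inj = λ s<N t<N → mod-injective s<N t<N ∘ c-inj }
    ; closes = subst (Adj E (p k) ∘ c) (fromℕ<-cong _ _ (n%n≡0 (suc k)) _ z<s) (adj-all k)
    ; long   = ≤-pred 3≤N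
    ; covers = λ a → let (i , cᵢ≡a) = c-covers a in toℕ i , toℕ<n i , trans (cong c (toℕ-mod i)) cᵢ≡a
    }
    where
    p : ℕ → Vertex n m
    p t = c (t mod suc k)
    adj-all : ∀ t → Adj E (p t) (p (suc t))
    adj-all t = subst (Adj E (p t) ∘ c) (next-mod t) (c-adj (t mod suc k))

-- The cycle p 0 … p (a + suc t) read from p (suc t) on, so that it ends with p t.
rotate : ℕ → ℕ → (ℕ → A) → ℕ → A
rotate a t p = (λ s → p (suc t + s)) ⟨ a ⟩++ p

module _ {p : ℕ → A} (a t : ℕ) where

  rotate-first : rotate a t p 0 ≡ p (suc t)
  rotate-first = trans (++-left {a = a} z≤n) (cong p (+-identityʳ (suc t)))

  rotate-last : rotate a t p (a + suc t) ≡ p t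
  rotate-last = trans (cong (rotate a t p) (+-suc a t)) (++-right a)

module _ {E : BipGraph n m} {p : ℕ → Vertex n m} (a t : ℕ) where

  XCycle-rotate : XCycle E (a + suc t) p → XCycle E (a + suc t) (rotate a t p)
  XCycle-rotate C = record
    { path   = rotated
    ; closes = subst₂ (Adj E) (sym (rotate-last a t)) (sym (rotate-first a t))
                      (adj path (s≤s (m≤n+m (suc t) a)))
    ; long   = long
    ; covers = covers′
    }
    where
    open XCycle C
    N≡ : suc a + suc t ≡ suc t + suc a
    N≡ = +-comm (suc a) (suc t)
    disjoint : ∀ {v} → Visits (λ s → p (suc t + s)) (suc a) v → ¬ Visits p (suc t) v
    disjoint (s , s<a , eq) (s′ , s′≤t , eq′) =
      <⇒≱ s′≤t (≤-trans (m≤m+n (suc t) s) (≤-reflexive s≡s′))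
      where
      s≡s′ : suc t + s ≡ s′
      s≡s′ = inj path (subst (suc t + s <_) (sym N≡) (+-monoʳ-< (suc t) s<a))
                      (≤-trans s′≤t (m≤n+m (suc t) (suc a))) (trans eq (sym eq′))
    rotated : IsPath E (rotate a t p) (suc (a + suc t))
    rotated = IsPath-++ a (IsPath-drop (suc t) (subst (IsPath E p) N≡ path))
                          (IsPath-≤ (m≤n+m (suc t) (suc a)) path)
                          (subst (λ i → Adj E (p i) (p 0)) (+-comm a (suc t)) closes)
                          disjoint
    covers′ : CoversX (rotate a t p) (suc (a + suc t))
    covers′ x with covers x
    ... | r , r<N , eq with ≤⊎≡1+ t r
    ...   | inj₁ r≤t        = Visits-++ʳ {a = a} (r , s≤s r≤t , eq)
    ...   | inj₂ (s , refl) =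
      Visits-++ˡ (s , +-cancelˡ-< (suc t) s (suc a) (subst (suc t + s <_) N≡ r<N) , eq)

<⇒≡+1+ : ∀ {t} → t < k → ∃[ a ] k ≡ a + suc t
<⇒≡+1+ {k} {t} t<k = k ∸ suc t , sym (m∸n+n≡m t<k)

Joins : Fin n → Fin m → Vertex n m → Vertex n m → Set
Joins x y u v = (u ≡ inj₁ x × v ≡ inj₂ y) ⊎ (u ≡ inj₂ y × v ≡ inj₁ x)

module _ {E : BipGraph n m} {x : Fin n} {y : Fin m} where

  Adj-addEdge⁺ : ∀ {u v} → Adj E u v → Adj (addEdge E x y) u v
  Adj-addEdge⁺ {inj₁ a} {inj₂ b} e with ⌊ a Fin.≟ x ⌋ ∧ ⌊ b Fin.≟ y ⌋
  ... | true  = tt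
  ... | false = e
  Adj-addEdge⁺ {inj₂ b} {inj₁ a} e with ⌊ a Fin.≟ x ⌋ ∧ ⌊ b Fin.≟ y ⌋
  ... | true  = tt
  ... | false = e

  Adj-addEdge⁻ : ∀ {u v} → Adj (addEdge E x y) u v → Adj E u v ⊎ Joins x y u v
  Adj-addEdge⁻ {inj₁ a} {inj₂ b} e with a Fin.≟ x | b Fin.≟ y
  ... | yes refl | yes refl = inj₂ (inj₁ (refl , refl))
  ... | yes _    | no _     = inj₁ e
  ... | no _     | _        = inj₁ e
  Adj-addEdge⁻ {inj₂ b} {inj₁ a} e with a Fin.≟ x | b Fin.≟ y
  ... | yes refl | yes refl = inj₂ (inj₂ (refl , refl))
  ... | yes _    | no _     = inj₁ e
  ... | no _     | _        = inj₁ e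

  HasCycleThroughX-addEdge⁺ : HasCycleThroughX E → HasCycleThroughX (addEdge E x y)
  HasCycleThroughX-addEdge⁺ (k , c , (3≤N , c-inj , c-adj) , c-covers) =
    k , c , (3≤N , c-inj , λ i → Adj-addEdge⁺ {c i} {c (next i)} (c-adj i)) , c-covers

  -- On a path from x to y, the edge xy could only join p 0 and p k, forcing k = 1.
  XYPath-addEdge⁻ : ∀ {p} → IsPath (addEdge E x y) p (suc k) → p 0 ≡ inj₁ x → p k ≡ inj₂ y →
                    2 ≤ k → CoversX p (suc k) → XYPath E x y k p
  XYPath-addEdge⁻ {k = k} {p} P p₀≡x pₖ≡y 2≤k cover = record
    { path   = record { adj = adj′ ; inj = inj P }
    ; start  = p₀≡x
    ; end    = pₖ≡y
    ; long   = 2≤k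
    ; covers = cover
    }
    where
    adj′ : ∀ {t} → suc t < suc k → Adj E (p t) (p (suc t))
    adj′ {t} t<k with Adj-addEdge⁻ (adj P t<k)
    ... | inj₁ e = e
    ... | inj₂ (inj₁ (pₜ≡x , pₜ₊₁≡y)) = contradiction (subst (2 ≤_) k≡1 2≤k) λ { (s≤s ()) }
      where
      k≡1 : k ≡ 1
      k≡1 = trans (sym (inj P t<k ≤-refl (trans pₜ₊₁≡y (sym pₖ≡y))))
                  (cong suc (inj P (<⇒≤ t<k) z<s (trans pₜ≡x (sym p₀≡x))))
    ... | inj₂ (inj₂ (pₜ≡y , _)) =
      contradiction (inj P (<⇒≤ t<k) ≤-refl (trans pₜ≡y (sym pₖ≡y))) (<⇒≢ (≤-pred t<k))

  XCycle-addEdge⇒XYPath : ∀ {p} → XCycle (addEdge E x y) k p → ¬ Adj E (p k) (p 0) → ∃₂ (XYPath E x y)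
  XCycle-addEdge⇒XYPath {k = k} {p} C ¬closes with Adj-addEdge⁻ (XCycle.closes C)
  ... | inj₁ closes = contradiction closes ¬closes
  ... | inj₂ (inj₁ (pₖ≡x , p₀≡y)) =
    k , reverse k p , XYPath-addEdge⁻ (IsPath-reverse path) pₖ≡x (trans (cong p (n∸n≡0 k)) p₀≡y)
                                      long (Visits-reverse ∘ covers)
    where open XCycle C
  ... | inj₂ (inj₂ (pₖ≡y , p₀≡x)) = k , p , XYPath-addEdge⁻ path p₀≡x pₖ≡y long covers
    where open XCycle C

  XCycle-addEdge⁻ : ∀ {p} → XCycle (addEdge E x y) k p → ∃₂ (XCycle E) ⊎ ∃₂ (XYPath E x y)
  XCycle-addEdge⁻ {k = k} {p} C with anyUpTo? (λ t → ¬? (Adj? E (p t) (p (suc t)))) k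
  ... | yes (t , t<k , ¬e) with <⇒≡+1+ t<k
  ...   | a , refl = inj₂ (XCycle-addEdge⇒XYPath (XCycle-rotate a t C) ¬closes)
    where
    ¬closes : ¬ Adj E (rotate a t p (a + suc t)) (rotate a t p 0)
    ¬closes = subst₂ (λ u v → ¬ Adj E u v) (sym (rotate-last a t)) (sym (rotate-first a t)) ¬e
  XCycle-addEdge⁻ {k = k} {p} C | no noneMissing with Adj? E (p k) (p 0)
  ... | no ¬closes = inj₂ (XCycle-addEdge⇒XYPath C ¬closes)
  ... | yes closes = inj₁ (k , p , record
    { path   = record { adj = adj′ ; inj = inj path }
    ; closes = closes
    ; long   = long
    ; covers = covers
    })
    where
    open XCycle C using (path; long; covers)
    adj′ : ∀ {t} → suc t < suc k → Adj E (p t) (p (suc t))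
    adj′ {t} t<k = decidable-stable (Adj? E (p t) (p (suc t))) (λ ¬e → noneMissing (t , ≤-pred t<k , ¬e))

module _ {E : BipGraph n m} {p : ℕ → Vertex n m} {j i : ℕ} where

  -- The cycle p 0 … p j p k … p i; it drops only p (j+1) … p (i-1), which are not in X.
  pósa : IsPath E p (suc k) → CoversX p (suc k) → j < i → i ≤ k →
         Adj E (p 0) (p i) → Adj E (p j) (p k) →
         (∀ {r} → j < r → r < i → ∀ a → p r ≢ inj₁ a) →
         2 ≤ j + suc (k ∸ i) →
         XCycle E (j + suc (k ∸ i)) (p ⟨ j ⟩++ reverse k p)
  pósa {k = k} P cover j<i i≤k p₀~pᵢ pⱼ~pₖ gap 2≤ = record
    { path   = IsPath-++ j (IsPath-≤ (s≤s j≤k) P) (IsPath-≤ (s≤s (m∸n≤m k i)) (IsPath-reverse P))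
                           pⱼ~pₖ disjoint
    ; closes = subst₂ (Adj E) (sym last≡pᵢ) (sym (++-left {a = j} z≤n)) (Adj-sym E {p 0} p₀~pᵢ)
    ; long   = 2≤
    ; covers = covers′
    }
    where
    j≤k : j ≤ k
    j≤k = <⇒≤ (<-≤-trans j<i i≤k)
    disjoint : ∀ {v} → Visits p (suc j) v → ¬ Visits (reverse k p) (suc (k ∸ i)) v
    disjoint (s , s≤j , eq) (t , t≤k∸i , eq′) =
      <⇒≢ (<-≤-trans (≤-<-trans (≤-pred s≤j) j<i) i≤k∸t)
          (inj P (s≤s (≤-trans (≤-pred s≤j) j≤k)) (s≤s (m∸n≤m k t)) (trans eq (sym eq′)))
      where
      i≤k∸t : i ≤ k ∸ t
      i≤k∸t = subst (_≤ k ∸ t) (m∸[m∸n]≡n i≤k) (∸-monoʳ-≤ k (≤-pred t≤k∸i))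
    last≡pᵢ : (p ⟨ j ⟩++ reverse k p) (j + suc (k ∸ i)) ≡ p i
    last≡pᵢ = trans (cong (p ⟨ j ⟩++ reverse k p) (+-suc j (k ∸ i)))
                    (trans (++-right j) (cong p (m∸[m∸n]≡n i≤k)))
    covers′ : CoversX (p ⟨ j ⟩++ reverse k p) (suc (j + suc (k ∸ i)))
    covers′ a with cover a
    ... | r , r≤k , eq with r ≤? j | i ≤? r
    ...   | yes r≤j | _       = Visits-++ˡ (r , s≤s r≤j , eq)
    ...   | no  _   | yes i≤r = Visits-++ʳ {a = j} (k ∸ r , s≤s (∸-monoʳ-≤ k i≤r) , eq′)
      where
      eq′ : p (k ∸ (k ∸ r)) ≡ inj₁ a
      eq′ = trans (cong p (m∸[m∸n]≡n (≤-pred r≤k))) eq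
    ...   | no  r≰j | no  i≰r = contradiction eq (gap (≰⇒> r≰j) (≰⇒> i≰r) a)

j+[1+k∸[1+j]]≡k : ∀ {j} → j < k → j + suc (k ∸ suc j) ≡ k
j+[1+k∸[1+j]]≡k {k} {j} j<k = trans (+-suc j (k ∸ suc j)) (m+[n∸m]≡n j<k)

StepsAhead : (ℕ → A) → ℕ → ℕ → A → A → Set
StepsAhead p L d u v = ∃[ t ] d + t < L × p t ≡ u × p (d + t) ≡ v

StepsAhead-functional : ∀ {E : BipGraph n m} {p d u v v′} → IsPath E p L →
                        StepsAhead p L d u v → StepsAhead p L d u v′ → v ≡ v′
StepsAhead-functional {d = d} P (t , t< , pₜ≡u , eq) (t′ , t′< , pₜ′≡u , eq′)
  with inj P (≤-<-trans (m≤n+m t d) t<) (≤-<-trans (m≤n+m t′ d) t′<) (trans pₜ≡u (sym pₜ′≡u))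
... | refl = trans (sym eq) eq′

¬T⇒T-not : ∀ {b} → ¬ T b → T (not b)
¬T⇒T-not {true}  ¬t = ¬t tt
¬T⇒T-not {false} _  = tt

≤nonNeighbours⇒+degY≤n : (E : BipGraph n m) (y : Fin m) {d : ℕ} (P : Fin d → Bool) →
                          count P ≤ count (not ∘ λ a → E a y) → count P + degY E y ≤ n
≤nonNeighbours⇒+degY≤n {n} E y P P≤ = begin
  count P + degY E y                              ≡⟨ cong (count P +_) (degY≡count E y) ⟩
  count P + count (λ a → E a y)                   ≤⟨ +-monoˡ-≤ _ P≤ ⟩
  count (not ∘ λ a → E a y) + count (λ a → E a y) ≡⟨ count-not+count (λ a → E a y) ⟩
  n                                               ∎
  where open ≤-Reasoning

1+n<d₁+d₂ : ∀ {d₁ d₂} → n + 1 < 2 * d₁ → n + 1 < 2 * d₂ → suc n < d₁ + d₂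
1+n<d₁+d₂ {n} {d₁} {d₂} h₁ h₂ = *-cancelˡ-≤ 2 (begin
  2 * suc (suc n)         ≡⟨ double n ⟩
  suc (n + 1) + suc (n + 1) ≤⟨ +-mono-≤ h₁ h₂ ⟩
  2 * d₁ + 2 * d₂         ≡⟨ *-distribˡ-+ 2 d₁ d₂ ⟨
  2 * (d₁ + d₂)           ∎)
  where
  open ≤-Reasoning
  double : ∀ n → 2 * suc (suc n) ≡ suc (n + 1) + suc (n + 1)
  double = solve-∀

module _ {E : BipGraph n m} {x : Fin n} {y : Fin m} {p : ℕ → Vertex n m} (P : XYPath E x y k p) where

  open XYPath P

  noRotation⇒degX+degY≤n : (∀ {b} → T (E x b) → Visits p (suc k) (inj₂ b)) →
                            ¬ (∃[ j ] j < k × Adj E (p 0) (p (suc j)) × Adj E (p j) (p k)) →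
                            degX E x + degY E y ≤ n
  noRotation⇒degX+degY≤n onPath noRotation =
    subst (λ d → d + degY E y ≤ n) (sym (degX≡count E x))
      (≤nonNeighbours⇒+degY≤n E y (E x)
        (injection⇒count≤ (E x) (not ∘ λ a → E a y) Predecessor predecessor
          (λ r r′ → inj₂-injective (StepsAhead-functional path r r′))))
    where
    Predecessor : Fin m → Fin n → Set
    Predecessor b a = StepsAhead p (suc k) 1 (inj₁ a) (inj₂ b)
    predecessor : ∀ {b} → T (E x b) → ∃[ a ] Predecessor b a × T (not (E a y))
    predecessor {b} x~b with onPath x~b
    ... | zero  , _   , p₀≡b   = contradiction (trans (sym start) p₀≡b) λ ()
    ... | suc t , t<k , pₜ₊₁≡b with neighbour-of-Y E {p t} (subst (Adj E (p t)) pₜ₊₁≡b (adj path t<k))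
    ...   | a , pₜ≡a = a , (t , t<k , pₜ≡a , pₜ₊₁≡b) , ¬T⇒T-not λ a~y →
              noRotation (t , ≤-pred t<k , subst₂ (Adj E) (sym start) (sym pₜ₊₁≡b) x~b
                                         , subst₂ (Adj E) (sym pₜ≡a) (sym end) a~y)

  noRotation⇒degY+degY≤1+n : ∀ {z} → T (E x z) →
                              ¬ (∃[ j ] j < k × Adj E (inj₂ z) (p (suc j)) × Adj E ((inj₂ z ◂ p) j) (p k)) →
                              degY E z + degY E y ≤ suc n
  noRotation⇒degY+degY≤1+n {z} x~z noRotation =
    subst (λ d → d + degY E y ≤ suc n) (sym (trans (degY≡count E z) (count-∖ (λ a → E a z) x~z)))
      (s≤s (≤nonNeighbours⇒+degY≤n E y ((λ a → E a z) ∖ x)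
        (injection⇒count≤ ((λ a → E a z) ∖ x) (not ∘ λ a → E a y) TwoBefore twoBefore
          (λ r r′ → inj₁-injective (StepsAhead-functional path r r′)))))
    where
    TwoBefore : Fin n → Fin n → Set
    TwoBefore a a′ = StepsAhead p (suc k) 2 (inj₁ a′) (inj₁ a)
    twoBefore : ∀ {a} → T (((λ a → E a z) ∖ x) a) → ∃[ a′ ] TwoBefore a a′ × T (not (E a′ y))
    twoBefore {a} Pa with ∖-elim {P = λ a → E a z} Pa | covers a
    ... | a≢x , _   | zero , _ , p₀≡a = ⊥-elim (a≢x (inj₁-injective (trans (sym p₀≡a) start)))
    ... | _   , _   | suc zero , 1<N , p₁≡a = ⊥-elim (subst₂ (Adj E) start p₁≡a (adj path 1<N))
    ... | _   , a~z | suc (suc t) , t<k , pₜ₊₂≡a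
      with neighbour-of-X E {p (suc t)} (subst (Adj E (p (suc t))) pₜ₊₂≡a (adj path t<k))
    ...   | b , pₜ₊₁≡b
      with neighbour-of-Y E {p t} (subst (Adj E (p t)) pₜ₊₁≡b (adj path (≤-trans (n≤1+n _) t<k)))
    ...     | a′ , pₜ≡a′ = a′ , (t , t<k , pₜ≡a′ , pₜ₊₂≡a) , ¬T⇒T-not λ a′~y →
              noRotation (suc t , ≤-pred t<k , subst (Adj E (inj₂ z)) (sym pₜ₊₂≡a) a~z
                                             , subst₂ (Adj E) (sym pₜ≡a′) (sym end) a′~y)

  XYPath⇒XCycle-onPath : n + 1 ≤ degX E x + degY E y →
                         (∀ {b} → T (E x b) → Visits p (suc k) (inj₂ b)) → ∃₂ (XCycle E)
  XYPath⇒XCycle-onPath hxy onPath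
    with anyUpTo? (λ j → Adj? E (p 0) (p (suc j)) ×-dec Adj? E (p j) (p k)) k
  ... | yes (j , j<k , p₀~pⱼ₊₁ , pⱼ~pₖ) =
    _ , _ , pósa path covers ≤-refl j<k p₀~pⱼ₊₁ pⱼ~pₖ
                 (λ j<r r≤j → contradiction (≤-pred r≤j) (<⇒≱ j<r))
                 (subst (2 ≤_) (sym (j+[1+k∸[1+j]]≡k j<k)) long)
  ... | no noRotation =
    contradiction (≤-trans hxy (noRotation⇒degX+degY≤n onPath noRotation))
                  (λ n+1≤n → 1+n≰n (subst (_≤ n) (+-comm n 1) n+1≤n))

  XYPath⇒XCycle-offPath : (∀ b → n + 1 < 2 * degY E b) →
                          ∀ {z} → T (E x z) → ¬ Visits p (suc k) (inj₂ z) → ∃₂ (XCycle E)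
  XYPath⇒XCycle-offPath hY {z} x~z z∉p
    with anyUpTo? (λ j → Adj? E (inj₂ z) (p (suc j)) ×-dec Adj? E ((inj₂ z ◂ p) j) (p k)) k
  ... | yes (j , j<k , z~pⱼ₊₁ , qⱼ~y) =
    _ , _ , pósa qpath qcovers (≤-trans (n<1+n j) (n≤1+n _)) (s≤s j<k) z~pⱼ₊₁ qⱼ~y gap
                 (subst (2 ≤_) (sym (j+[1+k∸[1+j]]≡k j<k)) long)
    where
    q : ℕ → Vertex n m
    q = inj₂ z ◂ p
    qpath : IsPath E q (suc (suc k))
    qpath = IsPath-◂ path (subst (Adj E (inj₂ z)) (sym start) x~z) z∉p
    qcovers : CoversX q (suc (suc k))
    qcovers a = let (r , r≤k , eq) = covers a in suc r , s≤s r≤k , eq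
    qⱼ~qⱼ₊₁ : Adj E (q j) (q (suc j))
    qⱼ~qⱼ₊₁ = adj qpath (s≤s (s≤s (<⇒≤ j<k)))
    gap : ∀ {r} → j < r → r < 2 + j → ∀ a → q r ≢ inj₁ a
    gap {r} j<r r<2+j a qᵣ≡a with ≤-antisym (≤-pred r<2+j) j<r
    ... | refl with neighbour-of-Y E {q j} (subst (Adj E (q j)) end qⱼ~y)
    ...   | a′ , qⱼ≡a′ = subst₂ (Adj E) qⱼ≡a′ qᵣ≡a qⱼ~qⱼ₊₁
  ... | no noRotation =
    contradiction (noRotation⇒degY+degY≤1+n x~z noRotation)
                  (<⇒≱ (1+n<d₁+d₂ {d₁ = degY E z} (hY z) (hY y)))

XYPath⇒XCycle : {E : BipGraph n m} {x : Fin n} {y : Fin m} {p : ℕ → Vertex n m} →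
                (∀ b → n + 1 < 2 * degY E b) → n + 1 ≤ degX E x + degY E y →
                XYPath E x y k p → ∃₂ (XCycle E)
XYPath⇒XCycle {k = k} {E = E} {x} {p = p} hY hxy P
  with any? (λ b → T? (E x b) ×-dec ¬? (Visits? _≟ᵛ_ p (suc k) (inj₂ b)))
... | yes (z , x~z , z∉p) = XYPath⇒XCycle-offPath P hY x~z z∉p
... | no noneOff = XYPath⇒XCycle-onPath P hxy λ {b} x~b →
  decidable-stable (Visits? _≟ᵛ_ p (suc k) (inj₂ b)) (λ b∉p → noneOff (b , x~b , b∉p))

lemma3p2 : (n m : ℕ) (E : BipGraph n m) →
           (∀ (b : Fin m) → n + 1 < 2 * degY E b) →
           (x : Fin n) (y : Fin m) → E x y ≡ false →
           n + 1 ≤ degX E x + degY E y →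
           (HasCycleThroughX (addEdge E x y) ⇔ HasCycleThroughX E)
lemma3p2 n m E hY x y _ hxy = mk⇔ to HasCycleThroughX-addEdge⁺
  where
  to : HasCycleThroughX (addEdge E x y) → HasCycleThroughX E
  to cycle with XCycle-addEdge⁻ (proj₂ (proj₂ (HasCycleThroughX⇒XCycle cycle)))
  ... | inj₁ (_ , _ , C) = XCycle⇒HasCycleThroughX C
  ... | inj₂ (_ , _ , P) = XCycle⇒HasCycleThroughX (proj₂ (proj₂ (XYPath⇒XCycle hY hxy P)))
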